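{- If $$\left|\{\, n \le x : n \ge 3,\ M(n) = 0 \,\}\right| = o(x) \quad \text{as } x \to \infty,$$ then $M(n) \neq 0$ for every integer $n \ge 3$.
   Context: For an integer $n \ge 3$, consider tilings of an $n \times n$ square by finitely many, and at least two, rectangles with integer side lengths which are pairwise incongruent (two rectangles are congruent if they have the same pair of side lengths, up to rotation). The score of such a tiling is the area of its largest rectangle minus the area of its smallest rectangle. $M(n)$ is the minimum score over all such tilings of the $n \times n$ square. -}

module Defs where

open import Data.Nat using (ℕ; _+_; _*_; _∸_; _≤_; _<_)
open import Data.Fin using (Fin)
open import Data.Product using (Σ; _×_; ∃)
open import Data.Sum using (_⊎_)
open import Data.List using (List; length)
open import Data.List.Relation.Unary.All using (All)
open import Data.List.Relation.Unary.Unique.Propositional using (Unique)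
open import Relation.Binary.PropositionalEquality using (_≡_; _≢_)
open import Relation.Nullary using (¬_)

record Rect : Set where
  constructor rect
  field
    x y w h : ℕ
open Rect public

area : Rect → ℕ
area r = w r * h r

-- r contains the unit cell [i, i+1] × [j, j+1]
Covers : Rect → ℕ → ℕ → Set
Covers r i j = (x r ≤ i × i < x r + w r) × (y r ≤ j × j < y r + h r)

Congruent : Rect → Rect → Set
Congruent r s = (w r ≡ w s × h r ≡ h s) ⊎ (w r ≡ h s × h r ≡ w s)

IsTiling : ℕ → (m : ℕ) → (Fin m → Rect) → Set
IsTiling n m R =
    2 ≤ m
  × (∀ k → 1 ≤ w (R k) × 1 ≤ h (R k) × x (R k) + w (R k) ≤ n × y (R k) + h (R k) ≤ n)
  × (∀ i j → i < n → j < n →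
       Σ (Fin m) λ k → Covers (R k) i j × (∀ k′ → Covers (R k′) i j → k′ ≡ k))
  × (∀ k k′ → k ≢ k′ → ¬ Congruent (R k) (R k′))

IsScore : (m : ℕ) → (Fin m → Rect) → ℕ → Set
IsScore m R s =
  Σ (Fin m) λ kmax → Σ (Fin m) λ kmin →
      (∀ k → area (R k) ≤ area (R kmax))
    × (∀ k → area (R kmin) ≤ area (R k))
    × s ≡ area (R kmax) ∸ area (R kmin)

HasScore : ℕ → ℕ → Set
HasScore n s = Σ ℕ λ m → Σ (Fin m → Rect) λ R → IsTiling n m R × IsScore m R s

MIs : ℕ → ℕ → Set
MIs n v = HasScore n v × (∀ s → HasScore n s → v ≤ s)

-- |{ n ≤ x : n ≥ 3, P n }| = o(x): for every k, eventually k·|S| ≤ x for every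
-- finite set S (a duplicate-free list) of such n.
SmallO : (ℕ → Set) → Set
SmallO P = ∀ (k : ℕ) → ∃ λ X → ∀ (x : ℕ) → X ≤ x →
  ∀ (ns : List ℕ) → Unique ns → All (λ n → n ≤ x × 3 ≤ n × P n) ns →
  k * length ns ≤ x

-- Scaling a tiling of the n × n square by a factor C scales every rectangle by C, keeps the
-- rectangles pairwise incongruent and multiplies every area, hence the score, by C². So a tiling
-- of score 0 of the n × n square yields one of the Cn × Cn square for every C ≥ 1: the set
-- {n ≥ 3 : M(n) = 0} is closed under multiples. If it contained some n, it would contain the
-- x / n multiples of n below x, a positive proportion, contradicting density zero.
module Submission where

open import Defs
open import Data.Nat using (ℕ; suc; _+_; _*_; _∸_; _≤_; _<_; z≤n; s≤s; _/_; NonZero; >-nonZero; >-nonZero⁻¹; _<?_)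
open import Data.Nat.Properties
open import Data.Nat.DivMod using (m*n/n≡m; /-monoˡ-≤; m/n*n≤m; m<n*o⇒m/o<n)
open import Data.Fin using (Fin)
open import Data.Product using (Σ; _×_; _,_)
open import Data.Sum using (inj₁; inj₂)
open import Data.List using (List; applyUpTo; length)
open import Data.List.Relation.Unary.Unique.Propositional using (Unique)
import Data.List.Relation.Unary.All.Properties as All
import Data.List.Relation.Unary.Unique.Propositional.Properties as Unique
open import Data.List.Properties using (length-applyUpTo)
open import Function using (_∘_)
open import Relation.Binary.PropositionalEquality
open import Relation.Nullary using (¬_; yes; no; contradiction)

module Scaling (C : ℕ) .{{_ : NonZero C}} where

  scale : Rect → Rect
  scale r = rect (x r * C) (y r * C) (w r * C) (h r * C)

  *-≤⇒≤-/ : ∀ {a i} → a * C ≤ i → a ≤ i / C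
  *-≤⇒≤-/ {a} {i} p = subst (_≤ i / C) (m*n/n≡m a C) (/-monoˡ-≤ C p)

  ≤-/⇒*-≤ : ∀ {a i} → a ≤ i / C → a * C ≤ i
  ≤-/⇒*-≤ {a} {i} p = ≤-trans (*-monoˡ-≤ C p) (m/n*n≤m i C)

  /-<⇒<-* : ∀ {i b} → i / C < b → i < b * C
  /-<⇒<-* {i} {b} p with i <? b * C
  ... | yes q = q
  ... | no  q = contradiction (*-≤⇒≤-/ (≮⇒≥ q)) (<⇒≱ p)

  scaled-interval⇒interval : ∀ {a b i} → a * C ≤ i × i < a * C + b * C → a ≤ i / C × i / C < a + b
  scaled-interval⇒interval {a} {b} {i} (p , q) =
    *-≤⇒≤-/ p , m<n*o⇒m/o<n (subst (i <_) (sym (*-distribʳ-+ C a b)) q)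

  interval⇒scaled-interval : ∀ {a b i} → a ≤ i / C × i / C < a + b → a * C ≤ i × i < a * C + b * C
  interval⇒scaled-interval {a} {b} {i} (p , q) =
    ≤-/⇒*-≤ p , subst (i <_) (*-distribʳ-+ C a b) (/-<⇒<-* q)

  covers-scale⇒covers : ∀ r {i j} → Covers (scale r) i j → Covers r (i / C) (j / C)
  covers-scale⇒covers r (p , q) = scaled-interval⇒interval p , scaled-interval⇒interval q

  covers⇒covers-scale : ∀ r {i j} → Covers r (i / C) (j / C) → Covers (scale r) i j
  covers⇒covers-scale r (p , q) = interval⇒scaled-interval p , interval⇒scaled-interval q

  congruent-scale⇒congruent : ∀ r s → Congruent (scale r) (scale s) → Congruent r s
  congruent-scale⇒congruent r s (inj₁ (p , q)) = inj₁ (*-cancelʳ-≡ _ _ C p , *-cancelʳ-≡ _ _ C q)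
  congruent-scale⇒congruent r s (inj₂ (p , q)) = inj₂ (*-cancelʳ-≡ _ _ C p , *-cancelʳ-≡ _ _ C q)

  area-scale : ∀ r → area (scale r) ≡ area r * (C * C)
  area-scale r = begin
    (w r * C) * (h r * C) ≡⟨ *-assoc (w r) C (h r * C) ⟩
    w r * (C * (h r * C)) ≡⟨ cong (w r *_) (*-comm C (h r * C)) ⟩
    w r * ((h r * C) * C) ≡⟨ cong (w r *_) (*-assoc (h r) C C) ⟩
    w r * (h r * (C * C)) ≡⟨ *-assoc (w r) (h r) (C * C) ⟨
    area r * (C * C)      ∎
    where open ≡-Reasoning

  area-scale-mono : ∀ r s → area r ≤ area s → area (scale r) ≤ area (scale s)
  area-scale-mono r s p rewrite area-scale r | area-scale s = *-monoˡ-≤ (C * C) p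

  isTiling-scale : ∀ {n m R} → IsTiling n m R → IsTiling (n * C) m (scale ∘ R)
  isTiling-scale {n} {m} {R} (two , bounded , covered , incongruent) =
    two , bounded-scale , covered-scale ,
    λ k k′ k≢k′ → incongruent k k′ k≢k′ ∘ congruent-scale⇒congruent (R k) (R k′)
    where
    1≤* : ∀ {a} → 1 ≤ a → 1 ≤ a * C
    1≤* p = *-mono-≤ p (>-nonZero⁻¹ C)

    +-≤-scale : ∀ a b → a + b ≤ n → a * C + b * C ≤ n * C
    +-≤-scale a b p = subst (_≤ n * C) (*-distribʳ-+ C a b) (*-monoˡ-≤ C p)

    bounded-scale : ∀ k → 1 ≤ w (scale (R k)) × 1 ≤ h (scale (R k))
                        × x (scale (R k)) + w (scale (R k)) ≤ n * C × y (scale (R k)) + h (scale (R k)) ≤ n * C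
    bounded-scale k with bounded k
    ... | 1≤w , 1≤h , x+w≤n , y+h≤n =
      1≤* 1≤w , 1≤* 1≤h ,
      +-≤-scale (x (R k)) (w (R k)) x+w≤n , +-≤-scale (y (R k)) (h (R k)) y+h≤n

    covered-scale : ∀ i j → i < n * C → j < n * C →
      Σ (Fin m) λ k → Covers (scale (R k)) i j × (∀ k′ → Covers (scale (R k′)) i j → k′ ≡ k)
    covered-scale i j i< j< with covered (i / C) (j / C) (m<n*o⇒m/o<n i<) (m<n*o⇒m/o<n j<)
    ... | k , covers , unique =
      k , covers⇒covers-scale (R k) covers , λ k′ → unique k′ ∘ covers-scale⇒covers (R k′)

  isScore-scale : ∀ {m R s} → IsScore m R s → IsScore m (scale ∘ R) (s * (C * C))
  isScore-scale {R = R} {s} (kmax , kmin , ≤max , min≤ , s≡) =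
    kmax , kmin , (λ k → area-scale-mono (R k) (R kmax) (≤max k))
                , (λ k → area-scale-mono (R kmin) (R k) (min≤ k))
                , score
    where
    open ≡-Reasoning
    score : s * (C * C) ≡ area (scale (R kmax)) ∸ area (scale (R kmin))
    score = begin
      s * (C * C)                                           ≡⟨ cong (_* (C * C)) s≡ ⟩
      (area (R kmax) ∸ area (R kmin)) * (C * C)             ≡⟨ *-distribʳ-∸ (C * C) (area (R kmax)) (area (R kmin)) ⟩
      area (R kmax) * (C * C) ∸ area (R kmin) * (C * C)     ≡⟨ cong₂ _∸_ (area-scale (R kmax)) (area-scale (R kmin)) ⟨
      area (scale (R kmax)) ∸ area (scale (R kmin))         ∎

  hasScore-scale : ∀ {n s} → HasScore n s → HasScore (n * C) (s * (C * C))
  hasScore-scale (m , R , tiling , score) = m , scale ∘ R , isTiling-scale tiling , isScore-scale {R = R} score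

M≡0-multiple : ∀ {n} C .{{_ : NonZero C}} → MIs n 0 → MIs (n * C) 0
M≡0-multiple C (hasScore , _) = Scaling.hasScore-scale C hasScore , λ _ _ → z≤n

multiples-not-SmallO : ∀ {P : ℕ → Set} {n} → 3 ≤ n → (∀ c → P (n * suc c)) → ¬ SmallO P
multiples-not-SmallO {P} {n} 3≤n P-multiples smallO with smallO (suc n)
... | X , bound = <-irrefl refl (begin-strict
    n * t                  <⟨ m<n+m (n * t) (s≤s z≤n) ⟩
    t + n * t              ≡⟨ cong (λ l → l + n * l) (length-applyUpTo multiple t) ⟨
    suc n * length ns      ≤⟨ bound (n * t) X≤nt ns unique-ns (All.applyUpTo⁺₁ multiple t small) ⟩
    n * t                  ∎)
  where
  open ≤-Reasoning
  instance
    n≢0 : NonZero n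
    n≢0 = >-nonZero (≤-trans (s≤s z≤n) 3≤n)

  t : ℕ
  t = suc X

  multiple : ℕ → ℕ
  multiple c = n * suc c

  ns : List ℕ
  ns = applyUpTo multiple t

  X≤nt : X ≤ n * t
  X≤nt = ≤-trans (n≤1+n X) (m≤n*m t n)

  unique-ns : Unique ns
  unique-ns = Unique.applyUpTo⁺₁ multiple t λ i<j _ e →
    <⇒≢ i<j (suc-injective (*-cancelˡ-≡ _ _ n e))

  small : ∀ {c} → c < t → multiple c ≤ n * t × 3 ≤ multiple c × P (multiple c)
  small {c} c<t = *-monoʳ-≤ n c<t , ≤-trans 3≤n (m≤m*n n (suc c)) , P-multiples c

mainTheorem3 : SmallO (λ n → MIs n 0) → ∀ (n : ℕ) → 3 ≤ n → ¬ MIs n 0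
mainTheorem3 smallO n 3≤n M≡0 = multiples-not-SmallO 3≤n (λ c → M≡0-multiple (suc c) M≡0) smallO
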